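{- Let $\delta>0$, $D>1$, let $H$ be an $n$-vertex graph satisfying property $\mathsf{Q}(\delta,D)$, and let $F$ be a graph with a clique $W\subseteq V(F)$ of size $\lfloor(1-3\delta)n\rfloor$. Let $K\in\mathbb{N}$ and let $F^{(K)}$ be a $K$-fold pasting of $F$ at $W$. If $F^{(K)}$ contains $H$ as a minor, then there exists $U\subseteq V(H)$ with $|U|\ge(1-\delta)n$ such that $F$ contains $H[U]$ as a minor.
   Context: Property $\mathsf{Q}(\delta,D)$: an $n$-vertex graph $H$ satisfies it if for every two disjoint $A,B\subseteq V(H)$ with $|A|,|B|\ge\delta n$, the number of edges of $H$ between $A$ and $B$ is at least $Dn\log n$ ($\log$ the natural logarithm). For a graph $F$, $S\subseteq V(F)$ and $K\in\mathbb{N}$, a $K$-fold pasting of $F$ at $S$ is any graph that is the union of $K$ isomorphic copies $F_1,\dots,F_K$ of $F$ (with $S$ corresponding to the same set in each copy) such that $V(F_i)\cap V(F_j)=S$ for all $1\le i<j\le K$. $H[U]$ denotes the induced subgraph of $H$ on $U$.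
   Formalization: The parameters δ and D are taken to be rational numbers, with δ positive and D greater than 1. -}

module Defs where

open import Data.Nat using (ℕ; zero; suc; _+_; _*_; _^_; _≤_; _<_; _!)
open import Data.Nat.Properties using (_!≢0)
open import Data.Integer using (+_)
open import Data.Rational as ℚ using (ℚ)
open import Data.Bool using (Bool; true; false; if_then_else_; _∧_)
open import Data.Fin using (Fin)
open import Data.Fin.Subset using (Subset; _∈_; ∣_∣)
open import Data.Vec using (lookup)
open import Data.Product using (Σ; ∃; ∃-syntax; _×_)
open import Data.Empty using (⊥)
open import Relation.Binary.PropositionalEquality using (_≡_; _≢_)
open import Relation.Nullary using (¬_)

record Graph : Set where
  field
    n      : ℕ
    adj    : Fin n → Fin n → Bool
    sym    : ∀ x y → adj x y ≡ adj y x
    irrefl : ∀ x → adj x x ≡ false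
open Graph public

Disjoint : ∀ {m} → Subset m → Subset m → Set
Disjoint A B = ∀ x → x ∈ A → x ∈ B → ⊥

sumFin : ∀ m → (Fin m → ℕ) → ℕ
sumFin zero    f = 0
sumFin (suc m) f = f Fin.zero + sumFin m (λ i → f (Fin.suc i))

-- number of edges between A and B (A, B disjoint, so each edge counted once)
eBetween : (H : Graph) → Subset (n H) → Subset (n H) → ℕ
eBetween H A B =
  sumFin (n H) λ x → sumFin (n H) λ y →
    if lookup A x ∧ lookup B y ∧ adj H x y then 1 else 0

-- Exponential comparison:  N ≤ e^k  (e = Euler's number), stated via
-- the partial sums  S_J(k) = Σ_{j<J} k^j / j!  which increase to e^k.

expPartial : ℕ → ℕ → ℚ
expPartial k zero    = ℚ.0ℚ
expPartial k (suc J) =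
  expPartial k J ℚ.+ ((+ (k ^ J)) ℚ./ (J !)) {{J !≢0}}

-- N ≤ e^k  iff  for every ε = 1/(m+1) some partial sum exceeds N - ε
LeExp : ℕ → ℕ → Set
LeExp N k = ∀ (m : ℕ) → ∃[ J ] (+ N ℚ./ 1 ℚ.≤ expPartial k J ℚ.+ (+ 1 ℚ./ suc m))

-- Property Q(δ, D) with δ = a / b and D = p / q.
--   |A| ≥ δ n          ⇔  a * n ≤ b * |A|
--   e(A,B) ≥ D n ln n  ⇔  p n ln n ≤ q e(A,B)  ⇔  n ^ (p * n) ≤ e ^ (q * e(A,B))

PropQ : (a b p q : ℕ) → Graph → Set
PropQ a b p q H =
  (A B : Subset (n H)) → Disjoint A B →
  a * n H ≤ b * ∣ A ∣ → a * n H ≤ b * ∣ B ∣ →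
  LeExp (n H ^ (p * n H)) (q * eBetween H A B)

IsClique : (F : Graph) → Subset (n F) → Set
IsClique F W = ∀ x y → x ∈ W → y ∈ W → x ≢ y → adj F x y ≡ true

data Walk (G : Graph) (S : Subset (n G)) : Fin (n G) → Fin (n G) → Set where
  here : ∀ {x} → x ∈ S → Walk G S x x
  step : ∀ {x y z} → x ∈ S → adj G x y ≡ true → Walk G S y z → Walk G S x z

Connected : (G : Graph) → Subset (n G) → Set
Connected G S = ∀ x y → x ∈ S → y ∈ S → Walk G S x y

-- Minors.  H[U] is a minor of G: branch sets V_h ⊆ V(G) for h ∈ U,
-- nonempty, connected in G, pairwise disjoint, and for every edge hh'
-- of H with h, h' ∈ U some edge of G joins V_h and V_h'.

InducedMinor : (H : Graph) → Subset (n H) → (G : Graph) → Set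
InducedMinor H U G =
  Σ (Fin (n H) → Subset (n G)) λ V →
    (∀ h → h ∈ U → ∃[ g ] (g ∈ V h)) ×
    (∀ h → h ∈ U → Connected G (V h)) ×
    (∀ h h' → h ∈ U → h' ∈ U → h ≢ h' → Disjoint (V h) (V h')) ×
    (∀ h h' → h ∈ U → h' ∈ U → adj H h h' ≡ true →
       ∃[ g ] ∃[ g' ] (g ∈ V h × g' ∈ V h' × adj G g g' ≡ true))

IsMinor : Graph → Graph → Set
IsMinor H G =
  Σ (Fin (n H) → Subset (n G)) λ V →
    (∀ h → ∃[ g ] (g ∈ V h)) ×
    (∀ h → Connected G (V h)) ×
    (∀ h h' → h ≢ h' → Disjoint (V h) (V h')) ×
    (∀ h h' → adj H h h' ≡ true →
       ∃[ g ] ∃[ g' ] (g ∈ V h × g' ∈ V h' × adj G g g' ≡ true))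

-- G is the union of K copies F_i = φ_i(F),
-- φ_i : V(F) → V(G) injective, with φ_i(S) the same set for all i,
-- V(F_i) ∩ V(F_j) = φ(S) for i ≠ j, V(G) = ∪ V(F_i), E(G) = ∪ E(F_i).

IsPasting : (K : ℕ) (F : Graph) (S : Subset (n F)) (G : Graph) → Set
IsPasting K F S G =
  Σ (Fin K → Fin (n F) → Fin (n G)) λ φ →
    (∀ i x y → φ i x ≡ φ i y → x ≡ y) ×
    (∀ i j x → x ∈ S → ∃[ y ] (y ∈ S × φ i x ≡ φ j y)) ×
    (∀ i j x y → i ≢ j → φ i x ≡ φ j y → x ∈ S) ×
    (∀ v → ∃[ i ] ∃[ x ] (φ i x ≡ v)) ×
    (∀ i x y → adj F x y ≡ true → adj G (φ i x) (φ i y) ≡ true) ×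
    (∀ u v → adj G u v ≡ true →
       ∃[ i ] ∃[ x ] ∃[ y ] (φ i x ≡ u × φ i y ≡ v × adj F x y ≡ true))

-- Call a vertex of H touching if its branch set meets the common part φ(W) of the
-- pasting. Touching branch sets are disjoint and meet φ_i(W) in every copy i, so there
-- are at most |W| touching vertices. Any other branch set avoids φ(W), hence lies in a
-- single copy, and adjacent non-touching vertices lie in the same copy. Property Q
-- forbids splitting the non-touching vertices, grouped by copy, into two parts of size
-- δn; as there are at least 3δn of them, one copy i holds all but δn. Preimages in
-- copy i then give the minor: a walk leaving copy i can only return through W, which
-- is a clique in F, so each excursion shortens to one edge.
module Submission where

open import Defs
open import Data.Bool using (Bool; true; false; not; _∧_; _∨_; if_then_else_; _≟_)
open import Data.Bool.Properties using (∧-zeroʳ; ∧-identityʳ; T-≡)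
open import Data.Empty using (⊥; ⊥-elim)
open import Data.Fin using (Fin; zero; suc; toℕ; fromℕ<)
open import Data.Fin.Properties using (any?; toℕ<n; toℕ-injective; toℕ-fromℕ<; suc-injective) renaming (_≟_ to _≟ᶠ_)
open import Data.Fin.Subset using (Subset; _∈_; ∣_∣; Nonempty) renaming (⊥ to ∅)
open import Data.Fin.Subset.Properties using (_∈?_; nonempty?; Empty-unique; ∣⊥∣≡0)
open import Data.Integer as ℤ using ()
import Data.Integer.Properties as ℤ
open import Data.Nat using (ℕ; zero; suc; _+_; _*_; _^_; _≤_; _<_; z≤n; s≤s; _!; _<ᵇ_; >-nonZero)
open import Data.Nat.Coprimality using (1-coprimeTo) renaming (sym to coprime-sym)
open import Data.Nat.Properties hiding (suc-injective; _≟_)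
open import Data.Product using (∃-syntax; _×_; _,_; proj₁; proj₂)
open import Data.Rational as ℚ using (mkℚ)
import Data.Rational.Properties as ℚ
open import Data.Sum using (_⊎_; inj₁; inj₂)
open import Data.Vec using (lookup; tabulate)
open import Data.Vec.Properties using (lookup∘tabulate; tabulate∘lookup; []=⇒lookup; lookup⇒[]=)
open import Function using (_∘_)
open import Function.Bundles using (Equivalence)
open import Relation.Binary.PropositionalEquality hiding (sym)
import Relation.Binary.PropositionalEquality as ≡
open import Relation.Nullary using (¬_; Dec; yes; no; does; contradiction)
open import Relation.Nullary.Decidable using (_×-dec_)
open import Relation.Nullary.Reflects using (ofⁿ)

count : ∀ {N} → (Fin N → Bool) → ℕ
count {zero}  P = 0
count {suc N} P = (if P zero then 1 else 0) + count (P ∘ suc)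

count-cong : ∀ {N} {P Q : Fin N → Bool} → (∀ x → P x ≡ Q x) → count P ≡ count Q
count-cong {zero}  P≗Q = refl
count-cong {suc N} P≗Q rewrite P≗Q zero = cong (_ +_) (count-cong (P≗Q ∘ suc))

count-mono : ∀ {N} {P Q : Fin N → Bool} → (∀ x → P x ≡ true → Q x ≡ true) → count P ≤ count Q
count-mono {zero}  P⇒Q = z≤n
count-mono {suc N} {P} {Q} P⇒Q with P zero | Q zero | P⇒Q zero
... | true  | true  | _     = s≤s (count-mono (P⇒Q ∘ suc))
... | true  | false | P₀⇒Q₀ = contradiction (P₀⇒Q₀ refl) λ ()
... | false | true  | _     = m≤n⇒m≤1+n (count-mono (P⇒Q ∘ suc))
... | false | false | _     = count-mono (P⇒Q ∘ suc)

count-split : ∀ {N} (P Q : Fin N → Bool) →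
  count P ≡ count (λ x → P x ∧ Q x) + count (λ x → P x ∧ not (Q x))
count-split {zero}  P Q = refl
count-split {suc N} P Q with P zero | Q zero
... | true  | true  = cong suc (count-split (P ∘ suc) (Q ∘ suc))
... | true  | false = trans (cong suc (count-split (P ∘ suc) (Q ∘ suc))) (≡.sym (+-suc _ _))
... | false | _     = count-split (P ∘ suc) (Q ∘ suc)

count-true : ∀ N → count {N} (λ _ → true) ≡ N
count-true zero    = refl
count-true (suc N) = cong suc (count-true N)

count-false : ∀ N → count {N} (λ _ → false) ≡ 0
count-false zero    = refl
count-false (suc N) = count-false N

count-∨ : ∀ {N} (P Q : Fin N → Bool) → count (λ x → P x ∨ Q x) ≤ count P + count Q
count-∨ {zero}  P Q = z≤n
count-∨ {suc N} P Q with P zero | Q zero | count-∨ (P ∘ suc) (Q ∘ suc)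
... | true  | true  | ih = s≤s (≤-trans ih (+-monoʳ-≤ (count (P ∘ suc)) (n≤1+n _)))
... | true  | false | ih = s≤s ih
... | false | true  | ih = ≤-trans (s≤s ih) (≤-reflexive (≡.sym (+-suc _ _)))
... | false | false | ih = ih

count-≟ : ∀ {N} (y : Fin N) → count (λ x → does (x ≟ᶠ y)) ≡ 1
count-≟ {suc N} zero    = cong suc (count-false N)
count-≟ {suc N} (suc y) = trans (count-cong (λ x → ≟ᶠ-suc x y)) (count-≟ y)
  where
  ≟ᶠ-suc : ∀ {N} (x y : Fin N) → does (suc x ≟ᶠ suc y) ≡ does (x ≟ᶠ y)
  ≟ᶠ-suc x y with x ≟ᶠ y
  ... | yes _ = refl
  ... | no  _ = refl

count-remove : ∀ {N} (Q : Fin N → Bool) {y} → Q y ≡ true →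
  count Q ≡ suc (count (λ x → Q x ∧ not (does (x ≟ᶠ y))))
count-remove Q {y} Qy = trans (count-split Q (λ x → does (x ≟ᶠ y)))
  (cong (_+ count (λ x → Q x ∧ not (does (x ≟ᶠ y)))) (trans (count-cong Q∧≡y) (count-≟ y)))
  where
  Q∧≡y : ∀ x → Q x ∧ does (x ≟ᶠ y) ≡ does (x ≟ᶠ y)
  Q∧≡y x with x ≟ᶠ y
  ... | yes refl rewrite Qy = refl
  ... | no  _    = ∧-zeroʳ (Q x)

count-injective : ∀ {N M} {P : Fin N → Bool} {Q : Fin M → Bool} (f : ∀ x → P x ≡ true → Fin M) →
  (∀ x Px → Q (f x Px) ≡ true) →
  (∀ x y Px Py → f x Px ≡ f y Py → x ≡ y) → count P ≤ count Q
count-injective {zero}  f maps inj = z≤n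
count-injective {suc N} {P = P} {Q} f maps inj with P zero in P₀
... | false = count-injective (f ∘ suc) (maps ∘ suc)
                (λ x y Px Py fx≡fy → suc-injective (inj (suc x) (suc y) Px Py fx≡fy))
... | true  = subst (_ ≤_) (≡.sym (count-remove Q (maps zero P₀)))
                (s≤s (count-injective (f ∘ suc) maps-suc
                  (λ x y Px Py fx≡fy → suc-injective (inj (suc x) (suc y) Px Py fx≡fy))))
  where
  maps-suc : ∀ x Px → Q (f (suc x) Px) ∧ not (does (f (suc x) Px ≟ᶠ f zero P₀)) ≡ true
  maps-suc x Px with f (suc x) Px ≟ᶠ f zero P₀
  ... | yes fx≡f₀ = contradiction (inj _ _ Px P₀ fx≡f₀) λ ()
  ... | no  _     = trans (∧-identityʳ _) (maps (suc x) Px)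

∣tabulate∣≡count : ∀ {N} (P : Fin N → Bool) → ∣ tabulate P ∣ ≡ count P
∣tabulate∣≡count {zero}  P = refl
∣tabulate∣≡count {suc N} P with P zero
... | true  = cong suc (∣tabulate∣≡count (P ∘ suc))
... | false = ∣tabulate∣≡count (P ∘ suc)

∣p∣≡count-lookup : ∀ {N} (p : Subset N) → ∣ p ∣ ≡ count (lookup p)
∣p∣≡count-lookup p = trans (cong ∣_∣ (≡.sym (tabulate∘lookup p))) (∣tabulate∣≡count (lookup p))

∈-tabulate⁺ : ∀ {N} {P : Fin N → Bool} {x} → P x ≡ true → x ∈ tabulate P
∈-tabulate⁺ {P = P} {x} Px = lookup⇒[]= x (tabulate P) (trans (lookup∘tabulate P x) Px)

∈-tabulate⁻ : ∀ {N} {P : Fin N → Bool} {x} → x ∈ tabulate P → P x ≡ true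
∈-tabulate⁻ {P = P} {x} x∈ = trans (≡.sym (lookup∘tabulate P x)) ([]=⇒lookup x∈)

nonempty-if-large : ∀ {N c} b (A : Subset N) → 1 ≤ c → c ≤ b * ∣ A ∣ → Nonempty A
nonempty-if-large {N} b A 1≤c c≤b∣A∣ with nonempty? A
... | yes nonempty = nonempty
... | no  empty    = contradiction (subst (1 ≤_) b∣A∣≡0 (≤-trans 1≤c c≤b∣A∣)) λ ()
  where
  b∣A∣≡0 : b * ∣ A ∣ ≡ 0
  b∣A∣≡0 = trans (cong (λ A → b * ∣ A ∣) (Empty-unique empty)) (trans (cong (b *_) (∣⊥∣≡0 N)) (*-zeroʳ b))

2≤-if-distinct : ∀ {N} {x y : Fin N} → x ≢ y → 2 ≤ N
2≤-if-distinct {1}           {zero} {zero} x≢y = contradiction refl x≢y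
2≤-if-distinct {suc (suc N)} _                 = s≤s (s≤s z≤n)

adjacent⇒distinct : ∀ H {x y} → adj H x y ≡ true → x ≢ y
adjacent⇒distinct H {x} xy refl = contradiction (trans (≡.sym xy) (irrefl H x)) λ ()

sumFin-zero : ∀ m {f : Fin m → ℕ} → (∀ i → f i ≡ 0) → sumFin m f ≡ 0
sumFin-zero zero    f≗0 = refl
sumFin-zero (suc m) f≗0 rewrite f≗0 zero = sumFin-zero m (f≗0 ∘ suc)

eBetween-no-edge : ∀ H (A B : Subset (n H)) →
  (∀ x y → x ∈ A → y ∈ B → adj H x y ≡ true → ⊥) → eBetween H A B ≡ 0
eBetween-no-edge H A B no-edge = sumFin-zero (n H) λ x → sumFin-zero (n H) λ y → no-summand x y
  where
  no-summand : ∀ x y → (if lookup A x ∧ lookup B y ∧ adj H x y then 1 else 0) ≡ 0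
  no-summand x y with lookup A x in x∈A | lookup B y in y∈B | adj H x y in xy
  ... | false | _     | _     = refl
  ... | true  | false | _     = refl
  ... | true  | true  | false = refl
  ... | true  | true  | true  = ⊥-elim (no-edge x y (lookup⇒[]= x A x∈A) (lookup⇒[]= y B y∈B) xy)

n/1≡mkℚ : ∀ m → ℤ.+ m ℚ./ 1 ≡ mkℚ (ℤ.+ m) 0 (coprime-sym (1-coprimeTo m))
n/1≡mkℚ m = ℚ.normalize-coprime (coprime-sym (1-coprimeTo m))

/1-cancel-≤ : ∀ {m n} → ℤ.+ m ℚ./ 1 ℚ.≤ ℤ.+ n ℚ./ 1 → m ≤ n
/1-cancel-≤ {m} {n} m≤n = ℤ.drop‿+≤+ (subst₂ ℤ._≤_ (ℤ.*-identityʳ (ℤ.+ m)) (ℤ.*-identityʳ (ℤ.+ n))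
  (ℚ.drop-*≤* (subst₂ ℚ._≤_ (n/1≡mkℚ m) (n/1≡mkℚ n) m≤n)))

expPartial-zero-suc : ∀ J → expPartial 0 (suc J) ≡ ℚ.1ℚ
expPartial-zero-suc zero    = refl
expPartial-zero-suc (suc J) = begin
  expPartial 0 (suc J) ℚ.+ (ℤ.+ 0 ℚ./ suc J !) {{suc J !≢0}}
    ≡⟨ cong₂ ℚ._+_ (expPartial-zero-suc J) (ℚ.0/n≡0 (suc J !) {{suc J !≢0}}) ⟩
  ℚ.1ℚ ℚ.+ ℚ.0ℚ
    ≡⟨ ℚ.+-identityʳ ℚ.1ℚ ⟩
  ℚ.1ℚ ∎
  where open ≡-Reasoning

expPartial-zero-≤1 : ∀ J → expPartial 0 J ℚ.≤ ℚ.1ℚ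
expPartial-zero-≤1 zero    = ℚ.*≤* (ℤ.+≤+ z≤n)
expPartial-zero-≤1 (suc J) = ℚ.≤-reflexive (expPartial-zero-suc J)

LeExp-zero⇒≤2 : ∀ {M} → LeExp M 0 → M ≤ 2
LeExp-zero⇒≤2 M≤e⁰ with M≤e⁰ 0
... | J , M≤S+1 = /1-cancel-≤ (ℚ.≤-trans M≤S+1 (ℚ.+-monoˡ-≤ (ℤ.+ 1 ℚ./ 1) (expPartial-zero-≤1 J)))

-- Without such an edge, Q(δ, D) would give n^(pn) ≤ e^0, impossible once n ≥ 2.
PropQ⇒crossing-edge : ∀ {a b p q H} → 1 ≤ a → q < p → 1 ≤ n H → PropQ a b p q H →
  (A B : Subset (n H)) → Disjoint A B → a * n H ≤ b * ∣ A ∣ → a * n H ≤ b * ∣ B ∣ →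
  ∃[ x ] ∃[ y ] (x ∈ A × y ∈ B × adj H x y ≡ true)
PropQ⇒crossing-edge {a} {b} {p} {q} {H} 1≤a q<p 1≤N Q A B A∩B=∅ A-large B-large
  with any? (λ x → any? (λ y → x ∈? A ×-dec y ∈? B ×-dec adj H x y ≟ true))
... | yes edge = edge
... | no  no-edge = contradiction (≤-trans 4≤N^pN (LeExp-zero⇒≤2 N^pN≤e⁰)) λ { (s≤s (s≤s ())) }
  where
  N = n H
  1≤aN : 1 ≤ a * N
  1≤aN = *-mono-≤ 1≤a 1≤N
  2≤N : 2 ≤ N
  2≤N with nonempty-if-large b A 1≤aN A-large | nonempty-if-large b B 1≤aN B-large
  ... | x , x∈A | y , y∈B = 2≤-if-distinct {x = x} {y} λ { refl → A∩B=∅ x x∈A y∈B }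
  N^pN≤e⁰ : LeExp (N ^ (p * N)) 0
  N^pN≤e⁰ = subst (LeExp (N ^ (p * N)))
    (trans (cong (q *_) (eBetween-no-edge H A B λ x y x∈A y∈B xy → no-edge (x , y , x∈A , y∈B , xy)))
      (*-zeroʳ q))
    (Q A B A∩B=∅ A-large B-large)
  4≤N^pN : 4 ≤ N ^ (p * N)
  4≤N^pN = begin
    2 ^ 2        ≤⟨ ^-monoˡ-≤ 2 2≤N ⟩
    N ^ 2        ≤⟨ ^-monoʳ-≤ N {{>-nonZero 1≤N}} (≤-trans 2≤N (m≤n*m N p {{>-nonZero 1≤p}})) ⟩
    N ^ (p * N)  ∎
    where
    open ≤-Reasoning
    1≤p : 1 ≤ p
    1≤p = ≤-trans (s≤s z≤n) q<p

window : (f : ℕ → ℕ) (K c : ℕ) → f 0 < c → c ≤ f K →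
  (∀ j → j < K → f (suc j) < f j + c) → ∃[ j ] (c ≤ f j × f j < c + c)
window f zero    c f₀<c c≤fK rise = contradiction c≤fK (<⇒≱ f₀<c)
window f (suc K) c f₀<c c≤fK rise with c ≤? f K
... | yes c≤fK' = window f K c f₀<c c≤fK' (λ j j<K → rise j (m≤n⇒m≤1+n j<K))
... | no  c≰fK  = suc K , c≤fK , <-≤-trans (rise K ≤-refl) (+-monoˡ-≤ c (<⇒≤ (≰⇒> c≰fK)))

remainder-large : ∀ b x {y N} c → N ≡ x + y → b * x + c < b * N → c ≤ b * y
remainder-large b x {y} c refl bx+c<bN =
  <⇒≤ (+-cancelˡ-< (b * x) c (b * y) (subst (b * x + c <_) (*-distribˡ-+ b x y) bx+c<bN))

+-below-3* : ∀ t {s} c → s < c + c → t + s + c < t + 3 * c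
+-below-3* t {s} c s<2c = begin-strict
  t + s + c        ≡⟨ +-assoc t s c ⟩
  t + (s + c)      <⟨ +-monoʳ-< t (+-monoˡ-< c s<2c) ⟩
  t + (c + c + c)  ≡⟨ cong (t +_) (trans (+-assoc c c c) (cong (λ d → c + (c + d)) (≡.sym (+-identityʳ c)))) ⟩
  t + 3 * c        ∎
  where open ≤-Reasoning

module LabelledPartition {N K} (T : Fin N → Bool) (label : Fin N → Fin K) where

  side : (Fin K → Bool) → Fin N → Bool
  side L h = not (T h) ∧ L (label h)

  class : Fin K → Fin N → Bool
  class i h = T h ∨ does (label h ≟ᶠ i)

  singleton : Fin K → Fin K → Bool
  singleton i j = does (j ≟ᶠ i)

  prefix : ℕ → Fin K → Bool
  prefix k j = toℕ j <ᵇ k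

  mass : (Fin K → Bool) → ℕ
  mass L = count (side L)

  partition : ∀ L → N ≡ count T + mass L + mass (not ∘ L)
  partition L = begin
    N                                          ≡⟨ ≡.sym (count-true N) ⟩
    count {N} (λ _ → true)                     ≡⟨ count-split (λ _ → true) T ⟩
    count T + count (not ∘ T)                  ≡⟨ cong (count T +_) (count-split (not ∘ T) (L ∘ label)) ⟩
    count T + (mass L + mass (not ∘ L))        ≡⟨ ≡.sym (+-assoc (count T) _ _) ⟩
    count T + mass L + mass (not ∘ L)          ∎
    where open ≡-Reasoning

  count-class : ∀ i → count (class i) ≡ count T + mass (singleton i)
  count-class i = trans (count-split (class i) T) (cong₂ _+_ (count-cong inside) (count-cong outside))
    where
    inside : ∀ h → class i h ∧ T h ≡ T h
    inside h with T h
    ... | true  = refl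
    ... | false = ∧-zeroʳ _
    outside : ∀ h → class i h ∧ not (T h) ≡ side (singleton i) h
    outside h with T h
    ... | true  = refl
    ... | false = ∧-identityʳ _

  mass-∨ : ∀ {L L₁ L₂} → (∀ j → L j ≡ true → L₁ j ∨ L₂ j ≡ true) → mass L ≤ mass L₁ + mass L₂
  mass-∨ {L} {L₁} {L₂} L⊆L₁∪L₂ = ≤-trans (count-mono side⊆) (count-∨ (side L₁) (side L₂))
    where
    side⊆ : ∀ h → side L h ≡ true → side L₁ h ∨ side L₂ h ≡ true
    side⊆ h with T h
    ... | true  = λ ()
    ... | false = L⊆L₁∪L₂ (label h)

  mass-empty : ∀ {L} → (∀ j → L j ≡ false) → mass L ≡ 0
  mass-empty {L} L≗∅ = trans (count-cong side-empty) (count-false N)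
    where
    side-empty : ∀ h → side L h ≡ false
    side-empty h rewrite L≗∅ (label h) = ∧-zeroʳ _

  sides-disjoint : ∀ L → Disjoint (tabulate (side L)) (tabulate (side (not ∘ L)))
  sides-disjoint L x x∈A x∈B with T x | L (label x) | ∈-tabulate⁻ x∈A | ∈-tabulate⁻ x∈B
  ... | false | true  | _  | ()
  ... | false | false | () | _
  ... | true  | _     | () | _

  prefix-all : ∀ j → not (prefix K j) ≡ false
  prefix-all j with toℕ j <ᵇ K | <ᵇ-reflects-< (toℕ j) K
  ... | true  | _         = refl
  ... | false | ofⁿ j≮K   = contradiction (toℕ<n j) j≮K

  prefix-suc : ∀ {k} (k<K : k < K) j → prefix (suc k) j ≡ true →
    prefix k j ∨ singleton (fromℕ< k<K) j ≡ true
  prefix-suc {k} k<K j j<1+k with toℕ j <ᵇ k | <ᵇ-reflects-< (toℕ j) k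
  ... | true  | _       = refl
  ... | false | ofⁿ j≮k with j ≟ᶠ fromℕ< k<K
  ...   | yes _   = refl
  ...   | no  j≢k = contradiction (toℕ-injective (trans j≡k (≡.sym (toℕ-fromℕ< k<K)))) j≢k
    where
    j≡k : toℕ j ≡ k
    j≡k = ≤-antisym (≤-pred (<ᵇ⇒< (toℕ j) (suc k) (Equivalence.from T-≡ j<1+k))) (≮⇒≥ j≮k)

  Balanced : ℕ → ℕ → (Fin K → Bool) → Set
  Balanced b c L = c ≤ b * mass L × c ≤ b * mass (not ∘ L)

  mass-prefix-zero : mass (prefix 0) ≡ 0
  mass-prefix-zero = mass-empty (λ _ → refl)

  mass-prefix-all : N ≡ count T + mass (prefix K)
  mass-prefix-all = trans (partition (prefix K))
    (trans (cong (count T + mass (prefix K) +_) (mass-empty prefix-all)) (+-identityʳ _))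

  mass-prefix-suc : ∀ {k} (k<K : k < K) → mass (prefix (suc k)) ≤ mass (prefix k) + mass (singleton (fromℕ< k<K))
  mass-prefix-suc {k} k<K = mass-∨ {prefix (suc k)} {prefix k} {singleton (fromℕ< k<K)} (prefix-suc k<K)

  small-atom : ∀ b c i → (∀ L → ¬ Balanced b c L) → b * count (class i) + c < b * N →
    b * mass (singleton i) < c
  small-atom b c i unbalanced class-small with c ≤? b * mass (singleton i)
  ... | no  c≰ = ≰⇒> c≰
  ... | yes c≤ = contradiction (c≤ , remainder-large b (count (class i)) c N≡ class-small) (unbalanced (singleton i))
    where
    N≡ : N ≡ count (class i) + mass (not ∘ singleton i)
    N≡ = trans (partition (singleton i)) (cong (_+ mass (not ∘ singleton i)) (≡.sym (count-class i)))

  -- If no class is large, every single label has mass below c/b, so some prefix of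
  -- the labels has mass in [c/b, 2c/b) and leaves at least c/b outside it.
  large-class : ∀ b c → 1 ≤ c → b * count T + 3 * c ≤ b * N → (∀ L → ¬ Balanced b c L) →
    ∃[ i ] (b * N ≤ b * count (class i) + c)
  large-class b c 1≤c room unbalanced with any? (λ i → b * N ≤? b * count (class i) + c)
  ... | yes found = found
  ... | no  none  = ⊥-elim (balanced-prefix (window f K c f₀<c c≤fK rise))
    where
    f : ℕ → ℕ
    f k = b * mass (prefix k)

    f₀<c : f 0 < c
    f₀<c = subst (_< c) (≡.sym (trans (cong (b *_) mass-prefix-zero) (*-zeroʳ b))) 1≤c

    c≤fK : c ≤ f K
    c≤fK = ≤-trans (m≤m+n c (2 * c)) (+-cancelˡ-≤ (b * count T) (3 * c) (f K)
      (subst (b * count T + 3 * c ≤_) (trans (cong (b *_) mass-prefix-all) (*-distribˡ-+ b (count T) _)) room))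

    rise : ∀ k → k < K → f (suc k) < f k + c
    rise k k<K = ≤-<-trans (≤-trans (*-monoʳ-≤ b (mass-prefix-suc k<K)) (≤-reflexive (*-distribˡ-+ b _ _)))
      (+-monoʳ-< (f k) (small-atom b c (fromℕ< k<K) unbalanced (≰⇒> (none ∘ (fromℕ< k<K ,_)))))

    balanced-prefix : ∃[ j ] (c ≤ f j × f j < c + c) → ⊥
    balanced-prefix (j , c≤fj , fj<2c) = unbalanced (prefix j) (c≤fj ,
      remainder-large b (count T + mass (prefix j)) c (partition (prefix j))
        (subst (_< b * N) (cong (_+ c) (≡.sym (*-distribˡ-+ b (count T) _)))
          (<-≤-trans (+-below-3* (b * count T) c fj<2c) room)))

module Pasting {K} {F : Graph} {W : Subset (n F)} {G : Graph} (pasting : IsPasting K F W G) where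

  φ : Fin K → Fin (n F) → Fin (n G)
  φ = proj₁ pasting

  φ-injective : ∀ i x y → φ i x ≡ φ i y → x ≡ y
  φ-injective = proj₁ (proj₂ pasting)

  φ-W : ∀ i j x → x ∈ W → ∃[ y ] (y ∈ W × φ i x ≡ φ j y)
  φ-W = proj₁ (proj₂ (proj₂ pasting))

  overlap⊆W : ∀ i j x y → i ≢ j → φ i x ≡ φ j y → x ∈ W
  overlap⊆W = proj₁ (proj₂ (proj₂ (proj₂ pasting)))

  covered : ∀ v → ∃[ i ] ∃[ x ] (φ i x ≡ v)
  covered = proj₁ (proj₂ (proj₂ (proj₂ (proj₂ pasting))))

  edge-in-copy : ∀ u v → adj G u v ≡ true →
    ∃[ i ] ∃[ x ] ∃[ y ] (φ i x ≡ u × φ i y ≡ v × adj F x y ≡ true)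
  edge-in-copy = proj₂ (proj₂ (proj₂ (proj₂ (proj₂ (proj₂ pasting)))))

  Shared : Fin (n G) → Set
  Shared g = ∃[ i ] ∃[ x ] (x ∈ W × φ i x ≡ g)

  shared? : ∀ g → Dec (Shared g)
  shared? g = any? λ i → any? λ x → x ∈? W ×-dec φ i x ≟ᶠ g

  same-copy : ∀ {g j x k y} → ¬ Shared g → φ j x ≡ g → φ k y ≡ g → j ≡ k
  same-copy {j = j} {x} {k} {y} ¬shared jx≡g ky≡g with j ≟ᶠ k
  ... | yes j≡k = j≡k
  ... | no  j≢k = contradiction (j , x , overlap⊆W j k x y j≢k (trans jx≡g (≡.sym ky≡g)) , jx≡g) ¬shared

  walk-within-copy : ∀ {S u v} → Walk G S u v → (∀ g → g ∈ S → ¬ Shared g) →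
    ∀ {j x k y} → φ j x ≡ u → φ k y ≡ v → j ≡ k
  walk-within-copy (here u∈S) avoids jx≡u ky≡u = same-copy (avoids _ u∈S) jx≡u ky≡u
  walk-within-copy (step u∈S uv rest) avoids jx≡u ky≡w with edge-in-copy _ _ uv
  ... | m , c , d , mc≡u , md≡v , _ =
    trans (same-copy (avoids _ u∈S) jx≡u mc≡u) (walk-within-copy rest avoids md≡v ky≡w)

  module Projection (clique : IsClique F W) (i : Fin K) where

    preimage : Subset (n G) → Subset (n F)
    preimage S = tabulate (λ x → lookup S (φ i x))

    ∈-preimage⁺ : ∀ {S x} → φ i x ∈ S → x ∈ preimage S
    ∈-preimage⁺ ix∈S = ∈-tabulate⁺ ([]=⇒lookup ix∈S)

    ∈-preimage⁻ : ∀ {S x} → x ∈ preimage S → φ i x ∈ S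
    ∈-preimage⁻ {S} x∈ = lookup⇒[]= _ S (∈-tabulate⁻ x∈)

    in-copy? : ∀ u → Dec (∃[ x ] φ i x ≡ u)
    in-copy? u = any? λ x → φ i x ≟ᶠ u

    shortcut : ∀ {S x z y} → x ∈ W → z ∈ W → x ∈ S → Walk F S z y → Walk F S x y
    shortcut {x = x} {z} x∈W z∈W x∈S walk with x ≟ᶠ z
    ... | yes refl = walk
    ... | no  x≢z  = step x∈S (clique x z x∈W z∈W x≢z) walk

    -- A walk leaves copy i only through the shared vertices, which W makes a clique,
    -- so every excursion outside the copy can be replaced by a single edge.
    mutual
      lift-walk : ∀ {S u v x y} → Walk G S u v → φ i x ≡ u → φ i y ≡ v → Walk F (preimage S) x y
      lift-walk {x = x} {y} (here u∈S) refl iy≡u =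
        subst (Walk F _ x) (φ-injective i x y (≡.sym iy≡u)) (here (∈-preimage⁺ u∈S))
      lift-walk {x = x} (step u∈S uv rest) refl iy≡w with edge-in-copy _ _ uv
      ... | m , c , d , mc≡u , md≡v , cd with i ≟ᶠ m
      ...   | yes refl = step (∈-preimage⁺ u∈S)
                (subst (λ c → adj F c d ≡ true) (φ-injective i c x mc≡u) cd) (lift-walk rest md≡v iy≡w)
      ...   | no  i≢m with in-copy? _
      ...     | yes (z , iz≡v) = shortcut x∈W (overlap⊆W i m z d i≢m (trans iz≡v (≡.sym md≡v)))
                  (∈-preimage⁺ u∈S) (lift-walk rest iz≡v iy≡w)
        where x∈W = overlap⊆W i m x c i≢m (≡.sym mc≡u)
      ...     | no  ∉copy with re-enter rest iy≡w (λ z iz≡v → ∉copy (z , iz≡v))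
      ...       | z , z∈W , walk = shortcut x∈W z∈W (∈-preimage⁺ u∈S) walk
        where x∈W = overlap⊆W i m x c i≢m (≡.sym mc≡u)

      re-enter : ∀ {S u v y} → Walk G S u v → φ i y ≡ v → (∀ x → φ i x ≢ u) →
        ∃[ z ] (z ∈ W × Walk F (preimage S) z y)
      re-enter (here _) iy≡u ∉copy = contradiction iy≡u (∉copy _)
      re-enter (step u∈S uv rest) iy≡w ∉copy with edge-in-copy _ _ uv
      ... | m , c , d , mc≡u , md≡v , _ with in-copy? _
      ...   | yes (z , iz≡v) = z , overlap⊆W i m z d i≢m (trans iz≡v (≡.sym md≡v)) , lift-walk rest iz≡v iy≡w
        where
        i≢m : i ≢ m
        i≢m refl = ∉copy c mc≡u
      ...   | no  ∉copy′ = re-enter rest iy≡w (λ z iz≡v → ∉copy′ (z , iz≡v))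

    preimage-connected : ∀ {S} → Connected G S → Connected F (preimage S)
    preimage-connected S-connected x y x∈ y∈ =
      lift-walk (S-connected (φ i x) (φ i y) (∈-preimage⁻ x∈) (∈-preimage⁻ y∈)) refl refl

module MinorOfPasting {H K F W G} (pasting : IsPasting K F W G) (minor : IsMinor H G) where
  open Pasting {F = F} {G = G} pasting

  branch : Fin (n H) → Subset (n G)
  branch = proj₁ minor

  root : Fin (n H) → Fin (n G)
  root h = proj₁ (proj₁ (proj₂ minor) h)

  root∈branch : ∀ h → root h ∈ branch h
  root∈branch h = proj₂ (proj₁ (proj₂ minor) h)

  branch-connected : ∀ h → Connected G (branch h)
  branch-connected = proj₁ (proj₂ (proj₂ minor))

  branch-disjoint : ∀ h h' → h ≢ h' → Disjoint (branch h) (branch h')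
  branch-disjoint = proj₁ (proj₂ (proj₂ (proj₂ minor)))

  branch-edge : ∀ h h' → adj H h h' ≡ true →
    ∃[ g ] ∃[ g' ] (g ∈ branch h × g' ∈ branch h' × adj G g g' ≡ true)
  branch-edge = proj₂ (proj₂ (proj₂ (proj₂ minor)))

  branch-edge-in-copy : ∀ h h' → adj H h h' ≡ true →
    ∃[ m ] ∃[ x ] ∃[ y ] (φ m x ∈ branch h × φ m y ∈ branch h' × adj F x y ≡ true)
  branch-edge-in-copy h h' hh' with branch-edge h h' hh'
  ... | g , g' , g∈ , g'∈ , gg' with edge-in-copy g g' gg'
  ...   | m , x , y , refl , refl , xy = m , x , y , g∈ , g'∈ , xy

  Touches : Fin (n H) → Set
  Touches h = ∃[ g ] (g ∈ branch h × Shared g)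

  touches? : ∀ h → Dec (Touches h)
  touches? h = any? λ g → g ∈? branch h ×-dec shared? g

  touches : Fin (n H) → Bool
  touches h = does (touches? h)

  copy : Fin (n H) → Fin K
  copy h = proj₁ (covered (root h))

  root-coordinate : ∀ h → ∃[ x ] (φ (copy h) x ∈ branch h)
  root-coordinate h with covered (root h)
  ... | _ , x , φx≡root = x , subst (_∈ branch h) (≡.sym φx≡root) (root∈branch h)

  copy-unique : ∀ h → ¬ Touches h → ∀ {j x} → φ j x ∈ branch h → j ≡ copy h
  copy-unique h ¬touches jx∈ = walk-within-copy (branch-connected h _ _ jx∈ (root∈branch h))
    (λ g g∈ shared → ¬touches (g , g∈ , shared)) refl (proj₂ (proj₂ (covered (root h))))

  copy-adjacent : ∀ h h' → ¬ Touches h → ¬ Touches h' → adj H h h' ≡ true → copy h ≡ copy h'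
  copy-adjacent h h' ¬th ¬th' hh' with branch-edge-in-copy h h' hh'
  ... | m , x , y , mx∈ , my∈ , _ = trans (≡.sym (copy-unique h ¬th mx∈)) (copy-unique h' ¬th' my∈)

  touching-in-copy : ∀ i h → Touches h → ∃[ y ] (y ∈ W × φ i y ∈ branch h)
  touching-in-copy i h (g , g∈ , m , x , x∈W , refl) with φ-W m i x x∈W
  ... | y , y∈W , mx≡iy = y , y∈W , subst (_∈ branch h) mx≡iy g∈

  Touches⁺ : ∀ {h} → touches h ≡ true → Touches h
  Touches⁺ {h} t with touches? h
  ... | yes touch = touch

  -- Distinct touching vertices have disjoint branch sets, so their shared vertices
  -- in any one copy are distinct elements of W.
  count-touches≤∣W∣ : Fin K → count touches ≤ ∣ W ∣
  count-touches≤∣W∣ i = subst (count touches ≤_) (≡.sym (∣p∣≡count-lookup W))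
    (count-injective anchor anchor∈W anchor-injective)
    where
    witness : ∀ h → touches h ≡ true → ∃[ y ] (y ∈ W × φ i y ∈ branch h)
    witness h t = touching-in-copy i h (Touches⁺ t)
    anchor : ∀ h → touches h ≡ true → Fin (n F)
    anchor h t = proj₁ (witness h t)
    anchor∈W : ∀ h t → lookup W (anchor h t) ≡ true
    anchor∈W h t = []=⇒lookup (proj₁ (proj₂ (witness h t)))
    anchor-injective : ∀ h h' t t' → anchor h t ≡ anchor h' t' → h ≡ h'
    anchor-injective h h' t t' same with h ≟ᶠ h' | witness h t | witness h' t'
    ... | yes h≡h' | _ | _ = h≡h'
    ... | no  h≢h' | _ , _ , iy∈ | _ , _ , iy'∈ rewrite same = ⊥-elim (branch-disjoint h h' h≢h' _ iy∈ iy'∈)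

  open LabelledPartition touches copy public

  side⇒outside : ∀ {L x} → side L x ≡ true → ¬ Touches x × L (copy x) ≡ true
  side⇒outside {L} {x} in-side with touches? x | L (copy x)
  ... | no ¬touches | true = ¬touches , refl
  ... | no _        | false = contradiction in-side λ ()
  ... | yes _       | _     = contradiction in-side λ ()

  no-edge-between-sides : ∀ L x y → side L x ≡ true → side (not ∘ L) y ≡ true → adj H x y ≡ true → ⊥
  no-edge-between-sides L x y x∈ y∈ xy with side⇒outside {L} x∈ | side⇒outside {not ∘ L} y∈
  ... | ¬tx , Lx | ¬ty , ¬Ly = contradiction
    (subst (λ b → not b ≡ true) Lx (subst (λ k → not (L k) ≡ true) (≡.sym (copy-adjacent x y ¬tx ¬ty xy)) ¬Ly))
    λ ()

  unbalanced : ∀ {a b p q} → 1 ≤ a → q < p → 1 ≤ n H → PropQ a b p q H →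
    ∀ L → ¬ Balanced b (a * n H) L
  unbalanced {a} {b} 1≤a q<p 1≤N Q L (A-large , B-large)
    with PropQ⇒crossing-edge {b = b} {H = H} 1≤a q<p 1≤N Q (tabulate (side L)) (tabulate (side (not ∘ L)))
           (sides-disjoint L)
           (subst (λ m → a * n H ≤ b * m) (≡.sym (∣tabulate∣≡count (side L))) A-large)
           (subst (λ m → a * n H ≤ b * m) (≡.sym (∣tabulate∣≡count (side (not ∘ L)))) B-large)
  ... | x , y , x∈A , y∈B , xy = no-edge-between-sides L x y (∈-tabulate⁻ x∈A) (∈-tabulate⁻ y∈B) xy

  member-of-class : ∀ {i h} → h ∈ tabulate (class i) → Touches h ⊎ (¬ Touches h × copy h ≡ i)
  member-of-class {i} {h} h∈ with touches? h | copy h ≟ᶠ i | ∈-tabulate⁻ {P = class i} h∈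
  ... | yes touch  | _       | _  = inj₁ touch
  ... | no ¬touch  | yes h↦i | _  = inj₂ (¬touch , h↦i)
  ... | no _       | no _    | ()

  class-minor : IsClique F W → ∀ i → InducedMinor H (tabulate (class i)) F
  class-minor clique i = preimage ∘ branch , nonempty , connected , disjoint , edges
    where
    open Pasting.Projection {F = F} {G = G} pasting clique i

    nonempty : ∀ h → h ∈ tabulate (class i) → ∃[ x ] (x ∈ preimage (branch h))
    nonempty h h∈ with member-of-class h∈
    ... | inj₁ touch with touching-in-copy i h touch
    ...   | y , _ , iy∈ = y , ∈-preimage⁺ iy∈
    nonempty h h∈ | inj₂ (_ , refl) with root-coordinate h
    ...   | x , x∈ = x , ∈-preimage⁺ x∈

    connected : ∀ h → h ∈ tabulate (class i) → Connected F (preimage (branch h))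
    connected h _ = preimage-connected (branch-connected h)

    disjoint : ∀ h h' → h ∈ tabulate (class i) → h' ∈ tabulate (class i) → h ≢ h' →
      Disjoint (preimage (branch h)) (preimage (branch h'))
    disjoint h h' _ _ h≢h' x x∈ x∈' = branch-disjoint h h' h≢h' (φ i x) (∈-preimage⁻ x∈) (∈-preimage⁻ x∈')

    Edge : Fin (n H) → Fin (n H) → Set
    Edge h h' = ∃[ x ] ∃[ y ] (x ∈ preimage (branch h) × y ∈ preimage (branch h') × adj F x y ≡ true)

    edge-forced : ∀ h h' → adj H h h' ≡ true →
      (∀ {m x y} → φ m x ∈ branch h → φ m y ∈ branch h' → m ≡ i) → Edge h h'
    edge-forced h h' hh' forced with branch-edge-in-copy h h' hh'
    ... | m , x , y , mx∈ , my∈ , xy with forced mx∈ my∈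
    ...   | refl = x , y , ∈-preimage⁺ mx∈ , ∈-preimage⁺ my∈ , xy

    edges : ∀ h h' → h ∈ tabulate (class i) → h' ∈ tabulate (class i) → adj H h h' ≡ true → Edge h h'
    edges h h' h∈ h'∈ hh' with member-of-class h∈ | member-of-class h'∈
    ... | inj₂ (¬th , h↦i) | _ = edge-forced h h' hh' λ mx∈ _ → trans (copy-unique h ¬th mx∈) h↦i
    ... | inj₁ _ | inj₂ (¬th' , h'↦i) = edge-forced h h' hh' λ _ my∈ → trans (copy-unique h' ¬th' my∈) h'↦i
    ... | inj₁ th | inj₁ th' with touching-in-copy i h th | touching-in-copy i h' th'
    ...   | y , y∈W , iy∈ | y' , y'∈W , iy'∈ with y ≟ᶠ y'
    ...     | no  y≢y' = y , y' , ∈-preimage⁺ iy∈ , ∈-preimage⁺ iy'∈ , clique y y' y∈W y'∈W y≢y'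
    ...     | yes refl = ⊥-elim (branch-disjoint h h' (adjacent⇒distinct H hh') (φ i y) iy∈ iy'∈)

minor-of-empty : ∀ a b {H} F → n H ≡ 0 → ∃[ U ] (b * n H ≤ b * ∣ U ∣ + a * n H × InducedMinor H U F)
minor-of-empty a b {H} F N≡0 = ∅ , bN≤ , (λ _ → ∅) , no-vertex , no-vertex , no-vertex , no-vertex
  where
  no-vertex : {A : Fin (n H) → Set} → ∀ h → A h
  no-vertex h with subst Fin N≡0 h
  ... | ()
  bN≤ : b * n H ≤ b * ∣ ∅ {n H} ∣ + a * n H
  bN≤ = subst (λ N → b * N ≤ b * ∣ ∅ {N} ∣ + a * N) (≡.sym N≡0) (≤-trans (≤-reflexive (*-zeroʳ b)) z≤n)

lemma4p4 : (a b : ℕ) → 1 ≤ a → 1 ≤ b → (p q : ℕ) → 1 ≤ q → q < p →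
    (H : Graph) → PropQ a b p q H →
    (F : Graph) → (W : Subset (Graph.n F)) → IsClique F W →
    b * ∣ W ∣ + 3 * a * Graph.n H ≤ b * Graph.n H →
    b * Graph.n H < b * ∣ W ∣ + b + 3 * a * Graph.n H →
    (K : ℕ) → (G : Graph) → IsPasting K F W G → IsMinor H G →
    ∃[ U ] (b * Graph.n H ≤ b * ∣ U ∣ + a * Graph.n H × InducedMinor H U F)
lemma4p4 a b 1≤a _ p q _ q<p H Q F W clique room _ K G pasting minor with 1 ≤? n H
... | no  N≱1 = minor-of-empty a b {H} F (n≤0⇒n≡0 (≮⇒≥ N≱1))
... | yes 1≤N = large-class-minor
  (large-class b (a * n H) (*-mono-≤ 1≤a 1≤N) touches-room (unbalanced {b = b} 1≤a q<p 1≤N Q))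
  where
  open MinorOfPasting {H = H} {F = F} {G = G} pasting minor

  touches-room : b * count touches + 3 * (a * n H) ≤ b * n H
  touches-room = ≤-trans (+-mono-≤ (*-monoʳ-≤ b (count-touches≤∣W∣ (copy (fromℕ< 1≤N))))
    (≤-reflexive (≡.sym (*-assoc 3 a (n H))))) room

  large-class-minor : ∃[ i ] (b * n H ≤ b * count (class i) + a * n H) →
    ∃[ U ] (b * n H ≤ b * ∣ U ∣ + a * n H × InducedMinor H U F)
  large-class-minor (i , covers) = tabulate (class i) ,
    subst (λ m → b * n H ≤ b * m + a * n H) (≡.sym (∣tabulate∣≡count (class i))) covers , class-minor clique i
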